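{- Let $G$ be a graph on $n$ cells, let $d$ divide $n$, and set $\ell=n/d$. Let $\mathcal{C}$ be the conflict graph whose nodes are the feasible districts (connected sets of exactly $\ell$ cells of $G$), with two nodes adjacent iff the corresponding districts share at least one cell. Then $\mathcal{C}$ is $(\ell+1)$-claw free, i.e., no node of $\mathcal{C}$ has $\ell+1$ distinct pairwise non-adjacent neighbors.
   Context: In this setting the population constraint is replaced by the cell-count constraint that every district contains exactly $n/d$ cells; a feasible district is a subset of exactly $n/d$ cells inducing a connected subgraph of $G$. -}

module Defs where

open import Data.Nat using (ℕ; suc; _/_; NonZero)
open import Data.Fin using (Fin)
open import Data.Fin.Subset using (Subset; _∈_; ∣_∣)
open import Data.Product using (Σ; ∃; _×_)
open import Relation.Binary.PropositionalEquality using (_≡_; _≢_)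
open import Relation.Nullary using (¬_)
open import Level using (0ℓ; suc)

record Graph (n : ℕ) : Set₁ where
  field
    Adj     : Fin n → Fin n → Set
    sym     : ∀ {u v} → Adj u v → Adj v u
    irrefl  : ∀ {u} → ¬ Adj u u
open Graph public

data PathIn {n : ℕ} (G : Graph n) (S : Subset n) : Fin n → Fin n → Set where
  here : ∀ {u} → u ∈ S → PathIn G S u u
  step : ∀ {u w v} → u ∈ S → Adj G u w → PathIn G S w v → PathIn G S u v

Connected : {n : ℕ} → Graph n → Subset n → Set
Connected G S = ∀ {u v} → u ∈ S → v ∈ S → PathIn G S u v

FeasibleDistrict : {n : ℕ} → Graph n → ℕ → Subset n → Set
FeasibleDistrict G ℓ S = (∣ S ∣ ≡ ℓ) × Connected G S

Conflict : {n : ℕ} → Subset n → Subset n → Set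
Conflict A B = (A ≢ B) × ∃ λ c → (c ∈ A) × (c ∈ B)

Claw : {n : ℕ} → Graph n → (ℓ k : ℕ) → Set
Claw {n} G ℓ k =
  Σ (Subset n) λ D → FeasibleDistrict G ℓ D ×
  Σ (Fin k → Subset n) λ B →
    (∀ i → FeasibleDistrict G ℓ (B i)) ×
    (∀ i → Conflict D (B i)) ×
    (∀ i j → i ≢ j → B i ≢ B j) ×
    (∀ i j → i ≢ j → ¬ Conflict (B i) (B j))

ClawFree : {n : ℕ} → Graph n → (ℓ k : ℕ) → Set
ClawFree G ℓ k = ¬ Claw G ℓ k

{-# OPTIONS --safe #-}
-- Each leaf of a claw centred at D shares some cell with D, and two different
-- leaves share no cell since they are non-adjacent. So choosing a shared cell
-- for every leaf is an injection into D, and a claw centred at a district of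
-- ℓ cells has at most ℓ leaves.
module Submission where

open import Defs
open import Data.Nat using (ℕ; suc; _/_; NonZero; _≤_; z≤n; s≤s)
open import Data.Nat.Divisibility using (_∣_)
open import Data.Nat.Properties using (≤-trans; 1+n≰n)
open import Data.Fin as Fin using (Fin; zero; _≟_)
open import Data.Fin.Properties using (0≢1+n; suc-injective)
open import Data.Fin.Subset using (Subset; _∈_; ∣_∣; _-_)
open import Data.Fin.Subset.Properties using (x∈p∧x≢y⇒x∈p-y; x∈p⇒∣p-x∣<∣p∣)
open import Data.Product using (_,_; proj₁; proj₂)
open import Function.Definitions using (Injective)
open import Relation.Binary.PropositionalEquality using (_≡_; _≢_; subst) renaming (sym to ≡-sym)
open import Relation.Nullary using (¬_)
open import Relation.Nullary.Decidable using (decidable-stable)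

injective-into⇒≤∣p∣ : ∀ {k n} {p : Subset n} (f : Fin k → Fin n) →
                      (∀ i → f i ∈ p) → Injective _≡_ _≡_ f → k ≤ ∣ p ∣
injective-into⇒≤∣p∣ {ℕ.zero}  f f∈p f-inj = z≤n
injective-into⇒≤∣p∣ {suc k} {p = p} f f∈p f-inj =
  ≤-trans (s≤s (injective-into⇒≤∣p∣ (λ i → f (Fin.suc i)) tail∈p-f0
                                     (λ eq → suc-injective (f-inj eq))))
          (x∈p⇒∣p-x∣<∣p∣ (f∈p zero))
  where
  tail∈p-f0 : ∀ i → f (Fin.suc i) ∈ p - f zero
  tail∈p-f0 i = x∈p∧x≢y⇒x∈p-y (f∈p (Fin.suc i)) (λ eq → 0≢1+n (≡-sym (f-inj eq)))

conflicting-antichain⇒≤∣D∣ : ∀ {k n} (D : Subset n) (B : Fin k → Subset n) →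
  (∀ i → Conflict D (B i)) →
  (∀ i j → i ≢ j → B i ≢ B j) →
  (∀ i j → i ≢ j → ¬ Conflict (B i) (B j)) →
  k ≤ ∣ D ∣
conflicting-antichain⇒≤∣D∣ D B conflict distinct antichain =
  injective-into⇒≤∣p∣ shared shared∈D shared-injective
  where
  shared : ∀ i → Fin _
  shared i = proj₁ (proj₂ (conflict i))

  shared∈D : ∀ i → shared i ∈ D
  shared∈D i = proj₁ (proj₂ (proj₂ (conflict i)))

  shared∈B : ∀ i → shared i ∈ B i
  shared∈B i = proj₂ (proj₂ (proj₂ (conflict i)))

  shared-injective : Injective _≡_ _≡_ shared
  shared-injective {i} {j} eq = decidable-stable (i ≟ j) λ i≢j →
    antichain i j i≢j (distinct i j i≢j , shared i , shared∈B i ,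
                       subst (_∈ B j) (≡-sym eq) (shared∈B j))

clawFree : ∀ {n} (G : Graph n) ℓ → ClawFree G ℓ (suc ℓ)
clawFree G ℓ (D , (∣D∣≡ℓ , _) , B , _ , conflict , distinct , antichain) =
  1+n≰n (subst (suc ℓ ≤_) ∣D∣≡ℓ (conflicting-antichain⇒≤∣D∣ D B conflict distinct antichain))

mainTheorem8 : (n d : ℕ) → .{{_ : NonZero d}} → d ∣ n → (G : Graph n)
    → ClawFree G (n / d) (suc (n / d))
mainTheorem8 n d _ G = clawFree G (n / d)
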